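{- Let $n$ be a natural number and let $0\leq a_1<\dots<a_k\leq n$ and $0\leq b_1<\dots<b_m\leq n$ be integers with $a_i\neq b_j$ for all $i,j$, such that \[\binom{n}{a_1}+\dots+\binom{n}{a_k}=\binom{n}{b_1}+\dots+\binom{n}{b_m}.\] Let $\mathcal{A}:=\{S\subseteq[n]\,:\,|S|\in\{a_1,\dots,a_k\}\}$ and $\mathcal{B}:=\{T\subseteq[n]\,:\,|T|\in\{b_1,\dots,b_m\}\}$. Then there exists a bijection $\Phi:\mathcal{A}\to\mathcal{B}$ such that for every $S\in\mathcal{A}$ we have either $S\subseteq\Phi(S)$ or $S\supseteq\Phi(S)$.
   Context: $[n]:=\{1,\dots,n\}$. An equality of the displayed form (with the stated conditions on the indices) is called a binomial identity, and the conclusion says the binomial identity is "orderable"; the theorem asserts all binomial identities are orderable. -}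

module Defs where

open import Data.Nat using (ℕ; suc; _+_)
open import Data.Nat.Combinatorics using (_C_)
open import Data.Fin using (Fin; toℕ)
open import Data.Fin.Subset using (Subset; _∈_; _∉_; _⊆_; ∣_∣; inside; outside)
open import Data.Vec using (_∷_; [])
open import Data.Product using (Σ; ∃; _×_; _,_; proj₁)
open import Data.Sum using (_⊎_)
open import Function.Bundles using (_⤖_; Bijection)
open import Relation.Binary.PropositionalEquality using (_≡_)

-- A set of indices {a_1 < ... < a_k} ⊆ {0,...,n} is a  Subset (suc n),
-- where element i : Fin (suc n) stands for the number toℕ i.

sumOver : ∀ {m} → Subset m → (ℕ → ℕ) → ℕ
sumOver [] f = 0
sumOver (inside ∷ p) f = f 0 + sumOver p (λ i → f (suc i))
sumOver (outside ∷ p) f = sumOver p (λ i → f (suc i))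

binomSum : ∀ n → Subset (suc n) → ℕ
binomSum n I = sumOver I (λ a → n C a)

SizeIn : ∀ {n} → Subset (suc n) → Subset n → Set
SizeIn I S = ∃ λ i → i ∈ I × toℕ i ≡ ∣ S ∣

Family : ∀ n → Subset (suc n) → Set
Family n I = Σ (Subset n) (SizeIn I)

Disjoint : ∀ {m} → Subset m → Subset m → Set
Disjoint {m} I J = ∀ (i : Fin m) → i ∈ I → i ∉ J

Orderable : ∀ n → Subset (suc n) → Subset (suc n) → Set
Orderable n A B =
  Σ (Family n A ⤖ Family n B) λ Φ →
    ∀ (S : Family n A) →
      let open Bijection Φ in
      (proj₁ S ⊆ proj₁ (to S)) ⊎ (proj₁ (to S) ⊆ proj₁ S)

-- Join S ∈ 𝒜 and T ∈ ℬ by an edge of weight C(n,∣S∣) C(n,∣T∣) c(S,T), where c(S,T) is the number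
-- of maximal chains ∅ ⊂ … ⊂ [n] passing through both S and T; it vanishes unless S and T are
-- comparable. A set of size a lies on a! (n-a)! maximal chains, and each of them meets exactly one
-- set of every size, so the total weight at S ∈ 𝒜 is n! ∑_{b ∈ B} C(n,b) and at T ∈ ℬ it is
-- n! ∑_{a ∈ A} C(n,a). When the two binomial sums agree, double counting gives Hall's condition,
-- and Hall's theorem (in Rado's form: edges can be deleted one at a time until only a matching
-- is left) gives a bijection 𝒜 → ℬ along edges, that is, along comparable pairs.

module Submission where

open import Defs
open import Data.Nat using (ℕ; zero; suc; _+_; _*_; _∸_; _≤_; _<_; z≤n; s≤s; _≤?_; _<?_; _!; >-nonZero)
open import Data.Nat.Properties
open import Data.Fin using (Fin; zero; suc; toℕ; _↑ˡ_; _↑ʳ_; splitAt)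
import Data.Fin as Fin
import Data.Fin.Properties as Fin
open import Data.Fin.Properties using (any?; toℕ≤pred[n]; splitAt-↑ˡ; splitAt-↑ʳ; splitAt⁻¹-↑ˡ; splitAt⁻¹-↑ʳ)
open import Data.Nat.Induction using (<-wellFounded)
open import Induction.WellFounded using (Acc; acc)
open import Data.Fin.Subset
open import Data.Fin.Subset.Properties
  using ( drop-there; ∈⊤; ∉⊥; _∈?_; _⊆?_; anySubset?; ∣⊤∣≡n; ∣p∣≤n; p⊆q⇒∣p∣≤∣q∣
        ; x∈⁅x⁆; x∈⁅y⁆⇒x≡y; ∣⁅x⁆∣≡1; x∈p∪q⁺; x∈p∪q⁻; x∈p∩q⁺; x∈p∩q⁻
        ; p─⊥≡p; p─q⊆p; x∈p∧x≢y⇒x∈p-y )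
open import Data.Vec using ([]; _∷_; here; there; tabulate)
open import Data.Product using (Σ; ∃; _×_; _,_; proj₁; proj₂)
open import Data.Sum using (_⊎_; inj₁; inj₂; [_,_]′)
open import Function using (id; _∘_)
open import Data.Empty using (⊥-elim)
import Data.Empty as Empty
open import Relation.Nullary using (¬_; ¬?; Dec; does; yes; no; contradiction)
open import Function.Bundles using (mk⤖)
open import Function.Definitions using (Injective; Surjective)
open import Data.Bool using (if_then_else_)
open import Data.Nat.Combinatorics using (_C_; nCk+nC[k+1]≡[n+1]C[k+1]; k![n∸k]!∣n!)
open import Data.Nat.Combinatorics.Specification using (nCk≡n!/k![n-k]!)
open import Data.Nat.DivMod using (m/n*n≡m)
open import Relation.Nullary.Decidable using (_×-dec_; dec-true; dec-false)
open import Relation.Binary.PropositionalEquality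
open import Data.Nat.Tactic.RingSolver using (solve-∀)
open import Algebra.Properties.CommutativeSemigroup *-commutativeSemigroup using (x∙yz≈y∙xz; x∙yz≈yx∙z; xy∙z≈xz∙y)

∑ : ∀ {m} → Subset m → (Fin m → ℕ) → ℕ
∑ []            f = 0
∑ (inside ∷ X)  f = f zero + ∑ X (f ∘ suc)
∑ (outside ∷ X) f = ∑ X (f ∘ suc)

sumOver≡∑ : ∀ {m} (X : Subset m) f → sumOver X f ≡ ∑ X (f ∘ toℕ)
sumOver≡∑ []            f = refl
sumOver≡∑ (inside ∷ X)  f = cong (f 0 +_) (sumOver≡∑ X (f ∘ suc))
sumOver≡∑ (outside ∷ X) f = sumOver≡∑ X (f ∘ suc)

∑-cong : ∀ {m} (X : Subset m) {f g} → (∀ i → i ∈ X → f i ≡ g i) → ∑ X f ≡ ∑ X g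
∑-cong [] h = refl
∑-cong (inside ∷ X) h = cong₂ _+_ (h zero here) (∑-cong X (λ i → h (suc i) ∘ there))
∑-cong (outside ∷ X) h = ∑-cong X (λ i → h (suc i) ∘ there)

∑-mono-≤ : ∀ {m} (X : Subset m) {f g} → (∀ i → i ∈ X → f i ≤ g i) → ∑ X f ≤ ∑ X g
∑-mono-≤ [] h = z≤n
∑-mono-≤ (inside ∷ X) h = +-mono-≤ (h zero here) (∑-mono-≤ X (λ i → h (suc i) ∘ there))
∑-mono-≤ (outside ∷ X) h = ∑-mono-≤ X (λ i → h (suc i) ∘ there)

∑-mono-⊆ : ∀ {m} {X Y : Subset m} f → X ⊆ Y → ∑ X f ≤ ∑ Y f
∑-mono-⊆ {X = []}          {[]}          f X⊆Y = z≤n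
∑-mono-⊆ {X = inside ∷ X}  {inside ∷ Y}  f X⊆Y = +-monoʳ-≤ (f zero) (∑-mono-⊆ _ (drop-there ∘ X⊆Y ∘ there))
∑-mono-⊆ {X = inside ∷ X}  {outside ∷ Y} f X⊆Y with X⊆Y here
... | ()
∑-mono-⊆ {X = outside ∷ X} {inside ∷ Y}  f X⊆Y = ≤-trans (∑-mono-⊆ _ (drop-there ∘ X⊆Y ∘ there)) (m≤n+m _ (f zero))
∑-mono-⊆ {X = outside ∷ X} {outside ∷ Y} f X⊆Y = ∑-mono-⊆ _ (drop-there ∘ X⊆Y ∘ there)

∑-const : ∀ {m} (X : Subset m) c → ∑ X (λ _ → c) ≡ ∣ X ∣ * c
∑-const [] c = refl
∑-const (inside ∷ X) c = cong (c +_) (∑-const X c)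
∑-const (outside ∷ X) c = ∑-const X c

∑-zero : ∀ {m} (X : Subset m) → ∑ X (λ _ → 0) ≡ 0
∑-zero X = trans (∑-const X 0) (*-zeroʳ ∣ X ∣)

∑-+ : ∀ {m} (X : Subset m) f g → ∑ X (λ i → f i + g i) ≡ ∑ X f + ∑ X g
∑-+ [] f g = refl
∑-+ (inside ∷ X) f g = trans (cong (f zero + g zero +_) (∑-+ X (f ∘ suc) (g ∘ suc)))
                             (+-+-swap (f zero) (g zero) _ _)
  where
  +-+-swap : ∀ a b c d → (a + b) + (c + d) ≡ (a + c) + (b + d)
  +-+-swap = solve-∀
∑-+ (outside ∷ X) f g = ∑-+ X (f ∘ suc) (g ∘ suc)

∑-*ˡ : ∀ {m} (X : Subset m) c f → ∑ X (λ i → c * f i) ≡ c * ∑ X f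
∑-*ˡ [] c f = sym (*-zeroʳ c)
∑-*ˡ (inside ∷ X) c f = trans (cong (c * f zero +_) (∑-*ˡ X c (f ∘ suc))) (sym (*-distribˡ-+ c (f zero) _))
∑-*ˡ (outside ∷ X) c f = ∑-*ˡ X c (f ∘ suc)

∑-*ʳ : ∀ {m} (X : Subset m) f c → ∑ X (λ i → f i * c) ≡ ∑ X f * c
∑-*ʳ X f c = trans (∑-cong X (λ i _ → *-comm (f i) c)) (trans (∑-*ˡ X c f) (*-comm c (∑ X f)))

∑-swap : ∀ {m k} (X : Subset m) (Y : Subset k) (W : Fin m → Fin k → ℕ) →
         ∑ X (λ i → ∑ Y (W i)) ≡ ∑ Y (λ j → ∑ X (λ i → W i j))
∑-swap [] Y W = sym (∑-zero Y)
∑-swap (inside ∷ X) Y W = trans (cong (∑ Y (W zero) +_) (∑-swap X Y (W ∘ suc)))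
                                (sym (∑-+ Y (W zero) (λ j → ∑ X (λ i → W (suc i) j))))
∑-swap (outside ∷ X) Y W = ∑-swap X Y (W ∘ suc)

∈⇒≤∑ : ∀ {m} (X : Subset m) f {i} → i ∈ X → f i ≤ ∑ X f
∈⇒≤∑ (inside ∷ X) f here = m≤m+n _ _
∈⇒≤∑ (inside ∷ X) f (there i∈X) = ≤-trans (∈⇒≤∑ X (f ∘ suc) i∈X) (m≤n+m _ _)
∈⇒≤∑ (outside ∷ X) f (there i∈X) = ∈⇒≤∑ X (f ∘ suc) i∈X

∑≢0⇒∃ : ∀ {m} (X : Subset m) f → ∑ X f ≢ 0 → ∃ λ i → i ∈ X × f i ≢ 0
∑≢0⇒∃ [] f ∑≢0 = contradiction refl ∑≢0
∑≢0⇒∃ (inside ∷ X) f ∑≢0 with f zero ≟ 0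
... | no f0≢0 = zero , here , f0≢0
... | yes f0≡0 with ∑≢0⇒∃ X (f ∘ suc) (λ ∑≡0 → ∑≢0 (cong₂ _+_ f0≡0 ∑≡0))
...   | i , i∈X , fi≢0 = suc i , there i∈X , fi≢0
∑≢0⇒∃ (outside ∷ X) f ∑≢0 with ∑≢0⇒∃ X (f ∘ suc) ∑≢0
... | i , i∈X , fi≢0 = suc i , there i∈X , fi≢0

∑⊤≡∑-support : ∀ {m} (Z : Subset m) f → (∀ i → i ∉ Z → f i ≡ 0) → ∑ ⊤ f ≡ ∑ Z f
∑⊤≡∑-support [] f h = refl
∑⊤≡∑-support (inside ∷ Z) f h =
  cong (f zero +_) (∑⊤≡∑-support Z (f ∘ suc) (λ i i∉Z → h (suc i) (i∉Z ∘ drop-there)))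
∑⊤≡∑-support (outside ∷ Z) f h =
  cong₂ _+_ (h zero λ ()) (∑⊤≡∑-support Z (f ∘ suc) (λ i i∉Z → h (suc i) (i∉Z ∘ drop-there)))

∑⊤-↑ : ∀ m {k} f → ∑ (⊤ {m + k}) f ≡ ∑ ⊤ (λ i → f (i ↑ˡ k)) + ∑ ⊤ (λ i → f (m ↑ʳ i))
∑⊤-↑ zero f = refl
∑⊤-↑ (suc m) f = trans (cong (f zero +_) (∑⊤-↑ m (f ∘ suc))) (sym (+-assoc (f zero) _ _))

∑⊤-< : ∀ {m} (f g : Fin m → ℕ) x → (∀ z → z ≢ x → f z ≡ g z) → f x < g x → ∑ ⊤ f < ∑ ⊤ g
∑⊤-< f g zero f≡g fx<gx =
  subst (λ r → f zero + ∑ ⊤ (f ∘ suc) < g zero + r) (∑-cong ⊤ (λ i _ → f≡g (suc i) λ ()))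
        (+-monoˡ-< _ fx<gx)
∑⊤-< f g (suc x) f≡g fx<gx =
  subst (λ r → f zero + ∑ ⊤ (f ∘ suc) < r + ∑ ⊤ (g ∘ suc)) (f≡g zero λ ())
        (+-monoʳ-< (f zero) (∑⊤-< (f ∘ suc) (g ∘ suc) x (λ z z≢x → f≡g (suc z) (z≢x ∘ Fin.suc-injective)) fx<gx))

∣p∪q∣+∣p∩q∣≡∣p∣+∣q∣ : ∀ {n} (p q : Subset n) → ∣ p ∪ q ∣ + ∣ p ∩ q ∣ ≡ ∣ p ∣ + ∣ q ∣
∣p∪q∣+∣p∩q∣≡∣p∣+∣q∣ [] [] = refl
∣p∪q∣+∣p∩q∣≡∣p∣+∣q∣ (inside ∷ p) (inside ∷ q) = cong suc (begin
  ∣ p ∪ q ∣ + suc ∣ p ∩ q ∣  ≡⟨ +-suc ∣ p ∪ q ∣ ∣ p ∩ q ∣ ⟩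
  suc (∣ p ∪ q ∣ + ∣ p ∩ q ∣) ≡⟨ cong suc (∣p∪q∣+∣p∩q∣≡∣p∣+∣q∣ p q) ⟩
  suc (∣ p ∣ + ∣ q ∣)         ≡⟨ +-suc ∣ p ∣ ∣ q ∣ ⟨
  ∣ p ∣ + suc ∣ q ∣           ∎)
  where open ≡-Reasoning
∣p∪q∣+∣p∩q∣≡∣p∣+∣q∣ (inside ∷ p) (outside ∷ q) = cong suc (∣p∪q∣+∣p∩q∣≡∣p∣+∣q∣ p q)
∣p∪q∣+∣p∩q∣≡∣p∣+∣q∣ (outside ∷ p) (inside ∷ q) =
  trans (cong suc (∣p∪q∣+∣p∩q∣≡∣p∣+∣q∣ p q)) (sym (+-suc ∣ p ∣ ∣ q ∣))
∣p∪q∣+∣p∩q∣≡∣p∣+∣q∣ (outside ∷ p) (outside ∷ q) = ∣p∪q∣+∣p∩q∣≡∣p∣+∣q∣ p q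

x∈p⇒suc∣p-x∣≡∣p∣ : ∀ {n} {x : Fin n} (p : Subset n) → x ∈ p → suc ∣ p - x ∣ ≡ ∣ p ∣
x∈p⇒suc∣p-x∣≡∣p∣ (inside ∷ p) here = cong (suc ∘ ∣_∣) (p─⊥≡p p)
x∈p⇒suc∣p-x∣≡∣p∣ (inside ∷ p) (there x∈p) = cong suc (x∈p⇒suc∣p-x∣≡∣p∣ p x∈p)
x∈p⇒suc∣p-x∣≡∣p∣ (outside ∷ p) (there x∈p) = x∈p⇒suc∣p-x∣≡∣p∣ p x∈p

x∈p-y⇒x≢y : ∀ {n} {x y : Fin n} (p : Subset n) → x ∈ p - y → x ≢ y
x∈p-y⇒x≢y {y = zero} (s ∷ p) (there x∈p-y) ()
x∈p-y⇒x≢y {y = suc y} (inside ∷ p) here ()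
x∈p-y⇒x≢y {y = suc y} (s ∷ p) (there x∈p-y) refl = x∈p-y⇒x≢y p x∈p-y refl

0<∣p∣⇒Nonempty : ∀ {n} (p : Subset n) → 0 < ∣ p ∣ → Nonempty p
0<∣p∣⇒Nonempty (inside ∷ p) _ = zero , here
0<∣p∣⇒Nonempty (outside ∷ p) 0<∣p∣ with 0<∣p∣⇒Nonempty p 0<∣p∣
... | x , x∈p = suc x , there x∈p

x∈p⇒0<∣p∣ : ∀ {n} {x : Fin n} {p : Subset n} → x ∈ p → 0 < ∣ p ∣
x∈p⇒0<∣p∣ {p = p} x∈p = subst (0 <_) (x∈p⇒suc∣p-x∣≡∣p∣ p x∈p) (s≤s z≤n)

x∈p∧y∈p∧x≢y⇒2≤∣p∣ : ∀ {n} {x y : Fin n} {p : Subset n} → x ∈ p → y ∈ p → x ≢ y → 2 ≤ ∣ p ∣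
x∈p∧y∈p∧x≢y⇒2≤∣p∣ {p = p} x∈p y∈p x≢y =
  subst (2 ≤_) (x∈p⇒suc∣p-x∣≡∣p∣ p x∈p) (s≤s (x∈p⇒0<∣p∣ (x∈p∧x≢y⇒x∈p-y y∈p (x≢y ∘ sym))))

p⊆q∧∣q∣≤∣p∣⇒q⊆p : ∀ {n} {p q : Subset n} → p ⊆ q → ∣ q ∣ ≤ ∣ p ∣ → q ⊆ p
p⊆q∧∣q∣≤∣p∣⇒q⊆p {p = p} {q} p⊆q ∣q∣≤∣p∣ {y} y∈q with y ∈? p
... | yes y∈p = y∈p
... | no y∉p = contradiction ∣q∣≤∣p∣ (<⇒≱ (begin-strict
  ∣ p ∣         ≤⟨ p⊆q⇒∣p∣≤∣q∣ p⊆q-y ⟩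
  ∣ q - y ∣     <⟨ n<1+n _ ⟩
  suc ∣ q - y ∣ ≡⟨ x∈p⇒suc∣p-x∣≡∣p∣ q y∈q ⟩
  ∣ q ∣         ∎))
  where
  open ≤-Reasoning
  p⊆q-y : p ⊆ q - y
  p⊆q-y z∈p = x∈p∧x≢y⇒x∈p-y (p⊆q z∈p) λ { refl → y∉p z∈p }

2≤∣p∣⇒distinct : ∀ {n} (p : Subset n) → 2 ≤ ∣ p ∣ → ∃ λ y₁ → ∃ λ y₂ → y₁ ∈ p × y₂ ∈ p × y₁ ≢ y₂
2≤∣p∣⇒distinct p 2≤∣p∣ with 0<∣p∣⇒Nonempty p (≤-trans (s≤s z≤n) 2≤∣p∣)
... | y₁ , y₁∈p with 0<∣p∣⇒Nonempty (p - y₁) (≤-pred (subst (2 ≤_) (sym (x∈p⇒suc∣p-x∣≡∣p∣ p y₁∈p)) 2≤∣p∣))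
...   | y₂ , y₂∈p-y₁ = y₁ , y₂ , y₁∈p , p─q⊆p p ⁅ y₁ ⁆ y₂∈p-y₁ , x∈p-y⇒x≢y p y₂∈p-y₁ ∘ sym

∪-least : ∀ {n} {p q r : Subset n} → p ⊆ r → q ⊆ r → p ∪ q ⊆ r
∪-least {p = p} {q} p⊆r q⊆r x∈p∪q with x∈p∪q⁻ p q x∈p∪q
... | inj₁ x∈p = p⊆r x∈p
... | inj₂ x∈q = q⊆r x∈q

-- Hall's theorem

Graph : ℕ → ℕ → Set
Graph p q = Fin p → Subset q

Γ : ∀ {p q} → Graph p q → Subset p → Subset q
Γ G []            = ⊥
Γ G (inside ∷ X)  = G zero ∪ Γ (G ∘ suc) X
Γ G (outside ∷ X) = Γ (G ∘ suc) X

Γ⁺ : ∀ {p q} (G : Graph p q) {X x y} → x ∈ X → y ∈ G x → y ∈ Γ G X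
Γ⁺ G {inside ∷ X} here y∈Gx = x∈p∪q⁺ (inj₁ y∈Gx)
Γ⁺ G {inside ∷ X} (there x∈X) y∈Gx = x∈p∪q⁺ (inj₂ (Γ⁺ (G ∘ suc) x∈X y∈Gx))
Γ⁺ G {outside ∷ X} (there x∈X) y∈Gx = Γ⁺ (G ∘ suc) x∈X y∈Gx

Γ⁻ : ∀ {p q} (G : Graph p q) (X : Subset p) {y} → y ∈ Γ G X → ∃ λ x → x ∈ X × y ∈ G x
Γ⁻ G [] y∈Γ = contradiction y∈Γ ∉⊥
Γ⁻ G (inside ∷ X) y∈Γ with x∈p∪q⁻ (G zero) (Γ (G ∘ suc) X) y∈Γ
... | inj₁ y∈G0 = zero , here , y∈G0
... | inj₂ y∈Γ′ with Γ⁻ (G ∘ suc) X y∈Γ′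
...   | x , x∈X , y∈Gx = suc x , there x∈X , y∈Gx
Γ⁻ G (outside ∷ X) y∈Γ with Γ⁻ (G ∘ suc) X y∈Γ
... | x , x∈X , y∈Gx = suc x , there x∈X , y∈Gx

Γ-mono : ∀ {p q} {G G′ : Graph p q} {X X′ : Subset p} →
         X ⊆ X′ → (∀ x → x ∈ X → G x ⊆ G′ x) → Γ G X ⊆ Γ G′ X′
Γ-mono {G = G} {G′} {X} X⊆X′ G⊆G′ y∈Γ with Γ⁻ G X y∈Γ
... | x , x∈X , y∈Gx = Γ⁺ G′ (X⊆X′ x∈X) (G⊆G′ x x∈X y∈Gx)

Γ⁅x⁆⊆G : ∀ {p q} (G : Graph p q) x → Γ G ⁅ x ⁆ ⊆ G x
Γ⁅x⁆⊆G G x y∈Γ with Γ⁻ G ⁅ x ⁆ y∈Γ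
... | z , z∈⁅x⁆ , y∈Gz = subst (λ w → _ ∈ G w) (x∈⁅y⁆⇒x≡y x z∈⁅x⁆) y∈Gz

HallCondition : ∀ {p q} → Graph p q → Subset p → Set
HallCondition G P = ∀ X → X ⊆ P → ∣ X ∣ ≤ ∣ Γ G X ∣

HallViolator : ∀ {p q} → Graph p q → Subset p → Subset p → Set
HallViolator G P X = X ⊆ P × ∣ Γ G X ∣ < ∣ X ∣

hall? : ∀ {p q} (G : Graph p q) (P : Subset p) → HallCondition G P ⊎ ∃ (HallViolator G P)
hall? G P with anySubset? (λ X → (X ⊆? P) ×-dec (∣ Γ G X ∣ <? ∣ X ∣))
... | yes violator = inj₂ violator
... | no ¬violator = inj₁ (λ X X⊆P → ≮⇒≥ (λ lt → ¬violator (X , X⊆P , lt)))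

deleteEdge : ∀ {p q} → Graph p q → Fin p → Fin q → Graph p q
deleteEdge G x y z with z Fin.≟ x
... | yes _ = G z - y
... | no  _ = G z

deleteEdge-⊆ : ∀ {p q} (G : Graph p q) x y z → deleteEdge G x y z ⊆ G z
deleteEdge-⊆ G x y z with z Fin.≟ x
... | yes _ = p─q⊆p (G z) ⁅ y ⁆
... | no  _ = id

deleteEdge⁺ : ∀ {p q} (G : Graph p q) x y {z w} → w ∈ G z → (z ≡ x → w ≢ y) → w ∈ deleteEdge G x y z
deleteEdge⁺ G x y {z} w∈Gz w≢y with z Fin.≟ x
... | yes z≡x = x∈p∧x≢y⇒x∈p-y w∈Gz (w≢y z≡x)
... | no  _   = w∈Gz

edgeCount : ∀ {p q} → Graph p q → ℕ
edgeCount G = ∑ ⊤ (∣_∣ ∘ G)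

edgeCount-deleteEdge : ∀ {p q} (G : Graph p q) x {y} → y ∈ G x → edgeCount (deleteEdge G x y) < edgeCount G
edgeCount-deleteEdge G x {y} y∈Gx = ∑⊤-< _ _ x other self
  where
  other : ∀ z → z ≢ x → ∣ deleteEdge G x y z ∣ ≡ ∣ G z ∣
  other z z≢x with z Fin.≟ x
  ... | yes z≡x = contradiction z≡x z≢x
  ... | no  _   = refl
  self : ∣ deleteEdge G x y x ∣ < ∣ G x ∣
  self with x Fin.≟ x
  ... | yes _   = subst (∣ G x - y ∣ <_) (x∈p⇒suc∣p-x∣≡∣p∣ (G x) y∈Gx) ≤-refl
  ... | no  x≢x = contradiction refl x≢x

violator∋deletedVertex : ∀ {p q} {G : Graph p q} {P : Subset p} x y {X} →
  HallCondition G P → HallViolator (deleteEdge G x y) P X → x ∈ X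
violator∋deletedVertex {G = G} x y {X} hall (X⊆P , violation) with x ∈? X
... | yes x∈X = x∈X
... | no  x∉X = contradiction (≤-trans (hall X X⊆P) (p⊆q⇒∣p∣≤∣q∣ (Γ-mono id G⊆G′))) (<⇒≱ violation)
  where
  G⊆G′ : ∀ z → z ∈ X → G z ⊆ deleteEdge G x y z
  G⊆G′ z z∈X w∈Gz = deleteEdge⁺ G x y w∈Gz λ { refl → contradiction z∈X x∉X }

-- Rado's lemma: by submodularity of ∣ Γ G _ ∣, violators X₁, X₂ of the two deletions would give
-- ∣ Γ G (X₁ ∪ X₂) ∣ + ∣ Γ G (X₁ ∩ X₂ - x) ∣ < ∣ X₁ ∪ X₂ ∣ + ∣ X₁ ∩ X₂ - x ∣, contradicting Hall for G.
deletions-cannot-both-violate : ∀ {p q} {G : Graph p q} {P : Subset p} {x y₁ y₂} →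
  HallCondition G P → x ∈ P → y₁ ≢ y₂ →
  ∀ {X₁ X₂} → HallViolator (deleteEdge G x y₁) P X₁ → HallViolator (deleteEdge G x y₂) P X₂ → Empty.⊥
deletions-cannot-both-violate {G = G} {P} {x} {y₁} {y₂} hall x∈P y₁≢y₂ {X₁} {X₂}
  v₁@(X₁⊆P , ∣U∣<∣X₁∣) v₂@(X₂⊆P , ∣V∣<∣X₂∣) = <-irrefl refl (begin-strict
    ∣ X₁ ∣ + ∣ X₂ ∣                 ≡⟨ ∣p∪q∣+∣p∩q∣≡∣p∣+∣q∣ X₁ X₂ ⟨
    ∣ X₁ ∪ X₂ ∣ + ∣ X₁ ∩ X₂ ∣       ≡⟨ cong (∣ X₁ ∪ X₂ ∣ +_) (x∈p⇒suc∣p-x∣≡∣p∣ (X₁ ∩ X₂) x∈X₁∩X₂) ⟨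
    ∣ X₁ ∪ X₂ ∣ + suc ∣ X₁ ∩ X₂ - x ∣ ≤⟨ +-mono-≤ ∣X₁∪X₂∣≤∣U∪V∣ (s≤s ∣X₁∩X₂-x∣≤∣U∩V∣) ⟩
    ∣ U ∪ V ∣ + suc ∣ U ∩ V ∣       ≡⟨ +-suc ∣ U ∪ V ∣ ∣ U ∩ V ∣ ⟩
    suc (∣ U ∪ V ∣ + ∣ U ∩ V ∣)     ≡⟨ cong suc (∣p∪q∣+∣p∩q∣≡∣p∣+∣q∣ U V) ⟩
    suc (∣ U ∣ + ∣ V ∣)             <⟨ s≤s (+-monoʳ-< ∣ U ∣ ∣V∣<∣X₂∣) ⟩
    suc ∣ U ∣ + ∣ X₂ ∣               ≤⟨ +-monoˡ-≤ ∣ X₂ ∣ ∣U∣<∣X₁∣ ⟩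
    ∣ X₁ ∣ + ∣ X₂ ∣                 ∎)
  where
  open ≤-Reasoning
  G₁ = deleteEdge G x y₁
  G₂ = deleteEdge G x y₂
  U = Γ G₁ X₁
  V = Γ G₂ X₂
  x∈X₁ : x ∈ X₁
  x∈X₁ = violator∋deletedVertex x y₁ hall v₁
  x∈X₂ : x ∈ X₂
  x∈X₂ = violator∋deletedVertex x y₂ hall v₂
  x∈X₁∩X₂ : x ∈ X₁ ∩ X₂
  x∈X₁∩X₂ = x∈p∩q⁺ (x∈X₁ , x∈X₂)
  ∩-⊆ˡ : ∀ {z} → z ∈ X₁ ∩ X₂ → z ∈ X₁
  ∩-⊆ˡ = proj₁ ∘ x∈p∩q⁻ X₁ X₂
  Γ∪⊆U∪V : Γ G (X₁ ∪ X₂) ⊆ U ∪ V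
  Γ∪⊆U∪V {w} w∈Γ with Γ⁻ G (X₁ ∪ X₂) w∈Γ
  ... | z , z∈X₁∪X₂ , w∈Gz with z Fin.≟ x | w Fin.≟ y₁ | x∈p∪q⁻ X₁ X₂ z∈X₁∪X₂
  ... | yes refl | yes refl | _ = x∈p∪q⁺ (inj₂ (Γ⁺ G₂ x∈X₂ (deleteEdge⁺ G x y₂ w∈Gz λ _ → y₁≢y₂)))
  ... | yes refl | no w≢y₁  | _ = x∈p∪q⁺ (inj₁ (Γ⁺ G₁ x∈X₁ (deleteEdge⁺ G x y₁ w∈Gz λ _ → w≢y₁)))
  ... | no z≢x   | _        | inj₁ z∈X₁ = x∈p∪q⁺ (inj₁ (Γ⁺ G₁ z∈X₁ (deleteEdge⁺ G x y₁ w∈Gz (⊥-elim ∘ z≢x))))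
  ... | no z≢x   | _        | inj₂ z∈X₂ = x∈p∪q⁺ (inj₂ (Γ⁺ G₂ z∈X₂ (deleteEdge⁺ G x y₂ w∈Gz (⊥-elim ∘ z≢x))))
  Γ∩⊆U∩V : Γ G (X₁ ∩ X₂ - x) ⊆ U ∩ V
  Γ∩⊆U∩V {w} w∈Γ with Γ⁻ G (X₁ ∩ X₂ - x) w∈Γ
  ... | z , z∈X₁∩X₂-x , w∈Gz with x∈p∩q⁻ X₁ X₂ (p─q⊆p _ _ z∈X₁∩X₂-x)
  ... | z∈X₁ , z∈X₂ = x∈p∩q⁺ ( Γ⁺ G₁ z∈X₁ (deleteEdge⁺ G x y₁ w∈Gz (⊥-elim ∘ z≢x))
                             , Γ⁺ G₂ z∈X₂ (deleteEdge⁺ G x y₂ w∈Gz (⊥-elim ∘ z≢x)))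
    where z≢x = x∈p-y⇒x≢y (X₁ ∩ X₂) z∈X₁∩X₂-x
  ∣X₁∪X₂∣≤∣U∪V∣ : ∣ X₁ ∪ X₂ ∣ ≤ ∣ U ∪ V ∣
  ∣X₁∪X₂∣≤∣U∪V∣ = ≤-trans (hall (X₁ ∪ X₂) (∪-least X₁⊆P X₂⊆P)) (p⊆q⇒∣p∣≤∣q∣ Γ∪⊆U∪V)
  ∣X₁∩X₂-x∣≤∣U∩V∣ : ∣ X₁ ∩ X₂ - x ∣ ≤ ∣ U ∩ V ∣
  ∣X₁∩X₂-x∣≤∣U∩V∣ = ≤-trans (hall (X₁ ∩ X₂ - x) (X₁⊆P ∘ ∩-⊆ˡ ∘ p─q⊆p (X₁ ∩ X₂) ⁅ x ⁆)) (p⊆q⇒∣p∣≤∣q∣ Γ∩⊆U∩V)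

record HallSubgraphOfDegree≤1 {p q} (G : Graph p q) (P : Subset p) : Set where
  field
    M        : Graph p q
    M⊆G      : ∀ z → M z ⊆ G z
    degree≤1 : ∀ z → z ∈ P → ∣ M z ∣ ≤ 1
    hall     : HallCondition M P

hallSubgraph-mono : ∀ {p q} {G G′ : Graph p q} {P : Subset p} →
  (∀ z → G′ z ⊆ G z) → HallSubgraphOfDegree≤1 G′ P → HallSubgraphOfDegree≤1 G P
hallSubgraph-mono G′⊆G 𝓜 = record { M = M ; M⊆G = λ z → G′⊆G z ∘ M⊆G z ; degree≤1 = degree≤1 ; hall = hall }
  where open HallSubgraphOfDegree≤1 𝓜

-- Rado's proof of Hall's theorem: while some vertex of P has two edges, one of them can be
-- deleted without violating Hall's condition.
rado : ∀ {p q} (G : Graph p q) (P : Subset p) → HallCondition G P → HallSubgraphOfDegree≤1 G P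
rado G P = go G (<-wellFounded (edgeCount G))
  where
  go : ∀ G → Acc _<_ (edgeCount G) → HallCondition G P → HallSubgraphOfDegree≤1 G P
  go G (acc rec) hall with any? (λ z → (z ∈? P) ×-dec (2 ≤? ∣ G z ∣))
  ... | no ¬big = record
    { M = G ; M⊆G = λ _ → id ; hall = hall
    ; degree≤1 = λ z z∈P → ≤-pred (≰⇒> (λ 2≤∣Gz∣ → ¬big (z , z∈P , 2≤∣Gz∣))) }
  ... | yes (x , x∈P , 2≤∣Gx∣) with 2≤∣p∣⇒distinct (G x) 2≤∣Gx∣
  ...   | y₁ , y₂ , y₁∈Gx , y₂∈Gx , y₁≢y₂ with hall? (deleteEdge G x y₁) P | hall? (deleteEdge G x y₂) P
  ...     | inj₁ hall₁ | _ = hallSubgraph-mono (deleteEdge-⊆ G x y₁)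
                              (go _ (rec (edgeCount-deleteEdge G x y₁∈Gx)) hall₁)
  ...     | inj₂ _ | inj₁ hall₂ = hallSubgraph-mono (deleteEdge-⊆ G x y₂)
                                   (go _ (rec (edgeCount-deleteEdge G x y₂∈Gx)) hall₂)
  ...     | inj₂ (_ , v₁) | inj₂ (_ , v₂) = ⊥-elim (deletions-cannot-both-violate hall x∈P y₁≢y₂ v₁ v₂)

module Matching {p q} {G : Graph p q} {P : Subset p} (𝓜 : HallSubgraphOfDegree≤1 G P) where

  open HallSubgraphOfDegree≤1 𝓜

  ⁅x⁆⊆P : ∀ {x} → x ∈ P → ⁅ x ⁆ ⊆ P
  ⁅x⁆⊆P x∈P z∈⁅x⁆ = subst (_∈ P) (sym (x∈⁅y⁆⇒x≡y _ z∈⁅x⁆)) x∈P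

  mate : ∀ x → x ∈ P → Fin q
  mate x x∈P = proj₁ (0<∣p∣⇒Nonempty (M x) (begin
    1               ≡⟨ ∣⁅x⁆∣≡1 x ⟨
    ∣ ⁅ x ⁆ ∣       ≤⟨ hall ⁅ x ⁆ (⁅x⁆⊆P x∈P) ⟩
    ∣ Γ M ⁅ x ⁆ ∣   ≤⟨ p⊆q⇒∣p∣≤∣q∣ (Γ⁅x⁆⊆G M x) ⟩
    ∣ M x ∣         ∎))
    where open ≤-Reasoning

  mate∈M : ∀ x (x∈P : x ∈ P) → mate x x∈P ∈ M x
  mate∈M x x∈P = proj₂ (0<∣p∣⇒Nonempty (M x) _)

  mate∈G : ∀ x (x∈P : x ∈ P) → mate x x∈P ∈ G x
  mate∈G x x∈P = M⊆G x (mate∈M x x∈P)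

  ∈M⇒≡mate : ∀ {x y} (x∈P : x ∈ P) → y ∈ M x → y ≡ mate x x∈P
  ∈M⇒≡mate {x} {y} x∈P y∈Mx with y Fin.≟ mate x x∈P
  ... | yes y≡mate = y≡mate
  ... | no  y≢mate = contradiction (≤-trans (x∈p∧y∈p∧x≢y⇒2≤∣p∣ y∈Mx (mate∈M x x∈P) y≢mate) (degree≤1 x x∈P)) λ { (s≤s ()) }

  mate-cong : ∀ {x x′} (x∈P : x ∈ P) (x′∈P : x′ ∈ P) → x ≡ x′ → mate x x∈P ≡ mate x′ x′∈P
  mate-cong x∈P x′∈P refl = sym (∈M⇒≡mate x∈P (mate∈M _ x′∈P))

  mate-injective : ∀ {x x′} (x∈P : x ∈ P) (x′∈P : x′ ∈ P) → mate x x∈P ≡ mate x′ x′∈P → x ≡ x′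
  mate-injective {x} {x′} x∈P x′∈P mate≡mate′ with x Fin.≟ x′
  ... | yes x≡x′ = x≡x′
  ... | no  x≢x′ = contradiction (begin
    2             ≤⟨ x∈p∧y∈p∧x≢y⇒2≤∣p∣ (x∈p∪q⁺ (inj₁ (x∈⁅x⁆ x))) (x∈p∪q⁺ (inj₂ (x∈⁅x⁆ x′))) x≢x′ ⟩
    ∣ X ∣         ≤⟨ hall X (∪-least (⁅x⁆⊆P x∈P) (⁅x⁆⊆P x′∈P)) ⟩
    ∣ Γ M X ∣     ≤⟨ p⊆q⇒∣p∣≤∣q∣ Γ⊆⁅mate⁆ ⟩
    ∣ ⁅ y ⁆ ∣      ≡⟨ ∣⁅x⁆∣≡1 y ⟩
    1             ∎) λ { (s≤s ()) }
    where
    open ≤-Reasoning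
    X = ⁅ x ⁆ ∪ ⁅ x′ ⁆
    y = mate x x∈P
    Γ⊆⁅mate⁆ : Γ M X ⊆ ⁅ y ⁆
    Γ⊆⁅mate⁆ w∈Γ with Γ⁻ M X w∈Γ
    ... | z , z∈X , w∈Mz with x∈p∪q⁻ ⁅ x ⁆ ⁅ x′ ⁆ z∈X
    ... | inj₁ z∈⁅x⁆ rewrite x∈⁅y⁆⇒x≡y x z∈⁅x⁆ =
      subst (_∈ ⁅ y ⁆) (sym (∈M⇒≡mate x∈P w∈Mz)) (x∈⁅x⁆ y)
    ... | inj₂ z∈⁅x′⁆ rewrite x∈⁅y⁆⇒x≡y x′ z∈⁅x′⁆ =
      subst (_∈ ⁅ y ⁆) (sym (trans (∈M⇒≡mate x′∈P w∈Mz) (sym mate≡mate′))) (x∈⁅x⁆ y)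

  mate-surjective : ∀ {Q} → (∀ z → z ∈ P → G z ⊆ Q) → ∣ Q ∣ ≤ ∣ P ∣ →
                    ∀ {y} → y ∈ Q → ∃ λ x → Σ (x ∈ P) λ x∈P → mate x x∈P ≡ y
  mate-surjective {Q} G⊆Q ∣Q∣≤∣P∣ y∈Q with Γ⁻ M P (p⊆q∧∣q∣≤∣p∣⇒q⊆p ΓP⊆Q (≤-trans ∣Q∣≤∣P∣ (hall P id)) y∈Q)
    where
    ΓP⊆Q : Γ M P ⊆ Q
    ΓP⊆Q w∈Γ with Γ⁻ M P w∈Γ
    ... | z , z∈P , w∈Mz = G⊆Q z z∈P (M⊆G z w∈Mz)
  ... | x , x∈P , y∈Mx = x , x∈P , sym (∈M⇒≡mate x∈P y∈Mx)

-- A weighting of the edges in which every vertex of P sends out at least D and every vertex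
-- receives at most D from P: double counting the weight leaving X ⊆ P gives ∣ X ∣ D ≤ ∣ Γ X ∣ D.
weighting⇒HallCondition : ∀ {p q} (G : Graph p q) (P : Subset p) (W : Fin p → Fin q → ℕ) D →
  (∀ x y → W x y ≢ 0 → y ∈ G x) →
  (∀ x → x ∈ P → D ≤ ∑ ⊤ (W x)) →
  (∀ y → ∑ P (λ x → W x y) ≤ D) →
  (∀ {x} → x ∈ P → 0 < D) →
  HallCondition G P
weighting⇒HallCondition G P W D W⊆G outflow inflow 0<D X X⊆P with ∣ X ∣ ≟ 0
... | yes ∣X∣≡0 = subst (_≤ ∣ Γ G X ∣) (sym ∣X∣≡0) z≤n
... | no  ∣X∣≢0 with 0<∣p∣⇒Nonempty X (n≢0⇒n>0 ∣X∣≢0)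
...   | x , x∈X = *-cancelʳ-≤ ∣ X ∣ ∣ Γ G X ∣ D {{>-nonZero (0<D (X⊆P x∈X))}} (begin
    ∣ X ∣ * D                             ≡⟨ ∑-const X D ⟨
    ∑ X (λ _ → D)                         ≤⟨ ∑-mono-≤ X (λ x x∈X → outflow x (X⊆P x∈X)) ⟩
    ∑ X (λ x → ∑ ⊤ (W x))                 ≡⟨ ∑-cong X (λ x x∈X → ∑⊤≡∑-support (Γ G X) (W x) (W-outside x∈X)) ⟩
    ∑ X (λ x → ∑ (Γ G X) (W x))           ≡⟨ ∑-swap X (Γ G X) W ⟩
    ∑ (Γ G X) (λ y → ∑ X (λ x → W x y))   ≤⟨ ∑-mono-≤ (Γ G X) (λ y _ → ∑-mono-⊆ (λ x → W x y) X⊆P) ⟩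
    ∑ (Γ G X) (λ y → ∑ P (λ x → W x y))   ≤⟨ ∑-mono-≤ (Γ G X) (λ y _ → inflow y) ⟩
    ∑ (Γ G X) (λ _ → D)                   ≡⟨ ∑-const (Γ G X) D ⟩
    ∣ Γ G X ∣ * D                         ∎)
  where
  open ≤-Reasoning
  W-outside : ∀ {x} → x ∈ X → ∀ y → y ∉ Γ G X → W x y ≡ 0
  W-outside {x} x∈X y y∉Γ with W x y ≟ 0
  ... | yes Wxy≡0 = Wxy≡0
  ... | no  Wxy≢0 = contradiction (Γ⁺ G x∈X (W⊆G x y Wxy≢0)) y∉Γ

-- Subsets and maximal chains of [n]

-- Subsets of [n] are numbered by Fin (∣𝒫∣ n), so that families of them are Subsets and
-- Hall's theorem above applies to the bipartite graph between 𝒜 and ℬ.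
∣𝒫∣ : ℕ → ℕ
∣𝒫∣ zero    = 1
∣𝒫∣ (suc n) = ∣𝒫∣ n + ∣𝒫∣ n

fromFin : ∀ n → Fin (∣𝒫∣ n) → Subset n
fromFin zero    _ = []
fromFin (suc n) i = [ (outside ∷_) ∘ fromFin n , (inside ∷_) ∘ fromFin n ]′ (splitAt (∣𝒫∣ n) i)

toFin : ∀ {n} → Subset n → Fin (∣𝒫∣ n)
toFin []                    = zero
toFin {suc n} (outside ∷ S) = toFin S ↑ˡ ∣𝒫∣ n
toFin {suc n} (inside ∷ S)  = ∣𝒫∣ n ↑ʳ toFin S

fromFin∘toFin : ∀ {n} (S : Subset n) → fromFin n (toFin S) ≡ S
fromFin∘toFin [] = refl
fromFin∘toFin {suc n} (outside ∷ S) rewrite splitAt-↑ˡ (∣𝒫∣ n) (toFin S) (∣𝒫∣ n) = cong (outside ∷_) (fromFin∘toFin S)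
fromFin∘toFin {suc n} (inside ∷ S)  rewrite splitAt-↑ʳ (∣𝒫∣ n) (∣𝒫∣ n) (toFin S) = cong (inside ∷_) (fromFin∘toFin S)

toFin∘fromFin : ∀ n (i : Fin (∣𝒫∣ n)) → toFin (fromFin n i) ≡ i
toFin∘fromFin zero    zero = refl
toFin∘fromFin (suc n) i with splitAt (∣𝒫∣ n) i in eq
... | inj₁ j = trans (cong (_↑ˡ ∣𝒫∣ n) (toFin∘fromFin n j)) (splitAt⁻¹-↑ˡ eq)
... | inj₂ j = trans (cong (∣𝒫∣ n ↑ʳ_) (toFin∘fromFin n j)) (splitAt⁻¹-↑ʳ eq)

∑𝒫 : ∀ {n} → (Subset n → ℕ) → ℕ
∑𝒫 {zero}  g = g []
∑𝒫 {suc n} g = ∑𝒫 (g ∘ (outside ∷_)) + ∑𝒫 (g ∘ (inside ∷_))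

∑⊤∘fromFin≡∑𝒫 : ∀ n (g : Subset n → ℕ) → ∑ ⊤ (g ∘ fromFin n) ≡ ∑𝒫 g
∑⊤∘fromFin≡∑𝒫 zero    g = +-identityʳ (g [])
∑⊤∘fromFin≡∑𝒫 (suc n) g = trans (∑⊤-↑ (∣𝒫∣ n) (g ∘ fromFin (suc n))) (cong₂ _+_
  (trans (∑-cong ⊤ (λ i _ → cong (g ∘ [ (outside ∷_) ∘ fromFin n , (inside ∷_) ∘ fromFin n ]′) (splitAt-↑ˡ (∣𝒫∣ n) i (∣𝒫∣ n))))
         (∑⊤∘fromFin≡∑𝒫 n (g ∘ (outside ∷_))))
  (trans (∑-cong ⊤ (λ i _ → cong (g ∘ [ (outside ∷_) ∘ fromFin n , (inside ∷_) ∘ fromFin n ]′) (splitAt-↑ʳ (∣𝒫∣ n) (∣𝒫∣ n) i)))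
         (∑⊤∘fromFin≡∑𝒫 n (g ∘ (inside ∷_)))))

∑𝒫-cong : ∀ {n} {f g : Subset n → ℕ} → (∀ S → f S ≡ g S) → ∑𝒫 f ≡ ∑𝒫 g
∑𝒫-cong {zero}  f≡g = f≡g []
∑𝒫-cong {suc n} f≡g = cong₂ _+_ (∑𝒫-cong (f≡g ∘ (outside ∷_))) (∑𝒫-cong (f≡g ∘ (inside ∷_)))

∑𝒫-zero : ∀ n → ∑𝒫 {n} (λ _ → 0) ≡ 0
∑𝒫-zero zero    = refl
∑𝒫-zero (suc n) = cong₂ _+_ (∑𝒫-zero n) (∑𝒫-zero n)

∑𝒫-*ˡ : ∀ {n} c (g : Subset n → ℕ) → ∑𝒫 (λ S → c * g S) ≡ c * ∑𝒫 g
∑𝒫-*ˡ {zero}  c g = refl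
∑𝒫-*ˡ {suc n} c g = trans (cong₂ _+_ (∑𝒫-*ˡ c (g ∘ (outside ∷_))) (∑𝒫-*ˡ c (g ∘ (inside ∷_))))
                          (sym (*-distribˡ-+ c _ _))

∑𝒫-*ʳ : ∀ {n} (g : Subset n → ℕ) c → ∑𝒫 (λ S → g S * c) ≡ ∑𝒫 g * c
∑𝒫-*ʳ g c = trans (∑𝒫-cong (λ S → *-comm (g S) c)) (trans (∑𝒫-*ˡ c g) (*-comm c (∑𝒫 g)))

∑𝒫-∑ : ∀ {n m} (X : Subset m) (F : Fin m → Subset n → ℕ) →
       ∑𝒫 (λ S → ∑ X (λ i → F i S)) ≡ ∑ X (λ i → ∑𝒫 (F i))
∑𝒫-∑ {n} X F = begin
  ∑𝒫 (λ S → ∑ X (λ i → F i S))            ≡⟨ ∑⊤∘fromFin≡∑𝒫 n _ ⟨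
  ∑ ⊤ (λ s → ∑ X (λ i → F i (fromFin n s))) ≡⟨ ∑-swap ⊤ X (λ s i → F i (fromFin n s)) ⟩
  ∑ X (λ i → ∑ ⊤ (F i ∘ fromFin n))          ≡⟨ ∑-cong X (λ i _ → ∑⊤∘fromFin≡∑𝒫 n (F i)) ⟩
  ∑ X (λ i → ∑𝒫 (F i))                    ∎
  where open ≡-Reasoning

*≢0⇒≢0ʳ : ∀ m {n} → m * n ≢ 0 → n ≢ 0
*≢0⇒≢0ʳ m m*n≢0 refl = m*n≢0 (*-zeroʳ m)

𝟙 : ∀ {a} {A : Set a} → Dec A → ℕ
𝟙 a? = if does a? then 1 else 0

𝟙-yes : ∀ {a} {A : Set a} (a? : Dec A) → A → 𝟙 a? ≡ 1
𝟙-yes a? a rewrite dec-true a? a = refl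

𝟙-no : ∀ {a} {A : Set a} (a? : Dec A) → ¬ A → 𝟙 a? ≡ 0
𝟙-no a? ¬a rewrite dec-false a? ¬a = refl

𝟙≢0⇒ : ∀ {a} {A : Set a} (a? : Dec A) → 𝟙 a? ≢ 0 → A
𝟙≢0⇒ (yes a) _ = a
𝟙≢0⇒ (no  _) 𝟙≢0 = contradiction refl 𝟙≢0

𝟙≤1 : ∀ {a} {A : Set a} (a? : Dec A) → 𝟙 a? ≤ 1
𝟙≤1 (yes _) = ≤-refl
𝟙≤1 (no  _) = z≤n

δ : ℕ → ℕ → ℕ
δ m k = 𝟙 (m ≟ k)

δ*-transport : ∀ {m k} (f : ℕ → ℕ) {c} → f m ≡ c → δ m k * f k ≡ δ m k * c
δ*-transport {m} {k} f fm≡c with m ≟ k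
... | yes refl rewrite 𝟙-yes (m ≟ m) refl = cong (1 *_) fm≡c
... | no  m≢k  rewrite 𝟙-no (m ≟ k) m≢k   = refl

countSupersets : ∀ {n} (S : Subset n) k → ∑𝒫 (λ T → 𝟙 (S ⊆? T) * δ ∣ T ∣ (∣ S ∣ + k)) ≡ (n ∸ ∣ S ∣) C k
countSupersets []     zero    = refl
countSupersets []     (suc k) = refl
countSupersets {suc n} (inside ∷ S) k = trans (cong (_+ ∑𝒫 (λ T → 𝟙 (S ⊆? T) * δ ∣ T ∣ (∣ S ∣ + k))) (∑𝒫-zero n)) (countSupersets S k)
countSupersets {suc n} (outside ∷ S) zero =
  trans (cong₂ _+_ (countSupersets S zero) (trans (∑𝒫-cong too-big) (∑𝒫-zero n))) refl
  where
  too-big : ∀ T → 𝟙 (S ⊆? T) * δ (suc ∣ T ∣) (∣ S ∣ + 0) ≡ 0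
  too-big T with S ⊆? T
  ... | no  _   = refl
  ... | yes S⊆T = cong (_+ 0) (𝟙-no (_ ≟ _) λ eq → <-irrefl refl (begin-strict
    ∣ S ∣      ≤⟨ p⊆q⇒∣p∣≤∣q∣ S⊆T ⟩
    ∣ T ∣      <⟨ n<1+n _ ⟩
    suc ∣ T ∣  ≡⟨ eq ⟩
    ∣ S ∣ + 0  ≡⟨ +-identityʳ _ ⟩
    ∣ S ∣      ∎))
    where open ≤-Reasoning
countSupersets {suc n} (outside ∷ S) (suc k) = begin
  ∑𝒫 (λ T → 𝟙 (S ⊆? T) * δ ∣ T ∣ (∣ S ∣ + suc k)) + ∑𝒫 (λ T → 𝟙 (S ⊆? T) * δ (suc ∣ T ∣) (∣ S ∣ + suc k))
    ≡⟨ cong₂ _+_ (countSupersets S (suc k))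
                 (trans (∑𝒫-cong (λ T → cong (λ r → 𝟙 (S ⊆? T) * δ (suc ∣ T ∣) r) (+-suc ∣ S ∣ k))) (countSupersets S k)) ⟩
  (n ∸ ∣ S ∣) C suc k + (n ∸ ∣ S ∣) C k
    ≡⟨ +-comm ((n ∸ ∣ S ∣) C suc k) _ ⟩
  (n ∸ ∣ S ∣) C k + (n ∸ ∣ S ∣) C suc k
    ≡⟨ nCk+nC[k+1]≡[n+1]C[k+1] (n ∸ ∣ S ∣) k ⟩
  suc (n ∸ ∣ S ∣) C suc k
    ≡⟨ cong (_C suc k) (+-∸-assoc 1 (∣p∣≤n S)) ⟨
  (suc n ∸ ∣ S ∣) C suc k ∎
  where open ≡-Reasoning

countSubsets : ∀ {n} (S : Subset n) b → ∑𝒫 (λ T → 𝟙 (T ⊆? S) * δ ∣ T ∣ b) ≡ ∣ S ∣ C b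
countSubsets []     zero    = refl
countSubsets []     (suc b) = refl
countSubsets {suc n} (outside ∷ S) b = trans (cong₂ _+_ (countSubsets S b) (∑𝒫-zero n)) (+-identityʳ _)
countSubsets {suc n} (inside ∷ S) zero =
  cong₂ _+_ (countSubsets S zero) (trans (∑𝒫-cong (λ T → *-zeroʳ (𝟙 (T ⊆? S)))) (∑𝒫-zero n))
countSubsets {suc n} (inside ∷ S) (suc b) =
  trans (cong₂ _+_ (countSubsets S (suc b)) (countSubsets S b))
        (trans (+-comm (∣ S ∣ C suc b) _) (nCk+nC[k+1]≡[n+1]C[k+1] ∣ S ∣ b))

countSubsetsOfSize : ∀ n k → ∑𝒫 {n} (λ S → δ ∣ S ∣ k) ≡ n C k
countSubsetsOfSize n k = begin
  ∑𝒫 {n} (λ S → δ ∣ S ∣ k)               ≡⟨ ∑𝒫-cong {n} (λ S → trans (cong (_* δ ∣ S ∣ k) (𝟙-yes (S ⊆? ⊤) (λ _ → ∈⊤)))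
                                                                (*-identityˡ _)) ⟨
  ∑𝒫 (λ S → 𝟙 (S ⊆? ⊤ {n}) * δ ∣ S ∣ k) ≡⟨ countSubsets (⊤ {n}) k ⟩
  ∣ ⊤ {n} ∣ C k                          ≡⟨ cong (_C k) (∣⊤∣≡n n) ⟩
  n C k                                  ∎
  where open ≡-Reasoning

nCk*k!*[n∸k]!≡n! : ∀ {n k} → k ≤ n → (n C k) * (k ! * (n ∸ k) !) ≡ n !
nCk*k!*[n∸k]!≡n! {n} {k} k≤n = trans (cong (_* (k ! * (n ∸ k) !)) (nCk≡n!/k![n-k]! k≤n))
                                     (m/n*n≡m {{k !* (n ∸ k) !≢0}} (k![n∸k]!∣n! k≤n))

chainCount : ℕ → ℕ → ℕ → ℕ
chainCount n a b = a ! * ((b ∸ a) ! * (n ∸ b) !)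

-- The number of maximal chains ∅ ⊂ … ⊂ [n] through both S and T when ∣ S ∣ = a and ∣ T ∣ = b:
-- a! (b - a)! (n - b)! if a ≤ b and S ⊆ T, symmetrically if b < a, and none if S, T are incomparable.
chainsThrough : ∀ {n} → ℕ → ℕ → Subset n → Subset n → ℕ
chainsThrough {n} a b S T =
  if does (a ≤? b) then 𝟙 (S ⊆? T) * chainCount n a b else 𝟙 (T ⊆? S) * chainCount n b a

chainsThrough-≤ : ∀ {n} {a b} (S T : Subset n) → a ≤ b → chainsThrough a b S T ≡ 𝟙 (S ⊆? T) * chainCount n a b
chainsThrough-≤ {a = a} {b} S T a≤b rewrite dec-true (a ≤? b) a≤b = refl

chainsThrough-> : ∀ {n} {a b} (S T : Subset n) → ¬ a ≤ b → chainsThrough a b S T ≡ 𝟙 (T ⊆? S) * chainCount n b a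
chainsThrough-> {a = a} {b} S T a≰b rewrite dec-false (a ≤? b) a≰b = refl

chainsThrough≢0⇒comparable : ∀ {n} a b (S T : Subset n) → chainsThrough a b S T ≢ 0 → S ⊆ T ⊎ T ⊆ S
chainsThrough≢0⇒comparable {n} a b S T ≢0 with a ≤? b
... | yes a≤b = inj₁ (𝟙≢0⇒ (S ⊆? T) λ 𝟙≡0 → ≢0 (trans (chainsThrough-≤ S T a≤b) (cong (_* chainCount n a b) 𝟙≡0)))
... | no  a≰b = inj₂ (𝟙≢0⇒ (T ⊆? S) λ 𝟙≡0 → ≢0 (trans (chainsThrough-> S T a≰b) (cong (_* chainCount n b a) 𝟙≡0)))

-- Both lemmas count the maximal chains through S, grouped by their element of size b.
chainsThrough-supersets : ∀ {n} (S : Subset n) b → ∣ S ∣ ≤ b → b ≤ n →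
  ∑𝒫 (λ T → 𝟙 (S ⊆? T) * δ ∣ T ∣ b) * chainCount n ∣ S ∣ b ≡ ∣ S ∣ ! * (n ∸ ∣ S ∣) !
chainsThrough-supersets {n} S b a≤b b≤n = begin
  ∑𝒫 (λ T → 𝟙 (S ⊆? T) * δ ∣ T ∣ b) * chainCount n a b
    ≡⟨ cong (λ b → ∑𝒫 (λ T → 𝟙 (S ⊆? T) * δ ∣ T ∣ b) * chainCount n a b) a+k≡b ⟨
  ∑𝒫 (λ T → 𝟙 (S ⊆? T) * δ ∣ T ∣ (a + k)) * chainCount n a (a + k)
    ≡⟨ cong (_* chainCount n a (a + k)) (countSupersets S k) ⟩
  ((n ∸ a) C k) * (a ! * ((a + k ∸ a) ! * (n ∸ (a + k)) !))
    ≡⟨ cong₂ (λ r s → ((n ∸ a) C k) * (a ! * (r ! * s !))) (m+n∸m≡n a k) (sym (∸-+-assoc n a k)) ⟩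
  ((n ∸ a) C k) * (a ! * (k ! * (n ∸ a ∸ k) !))
    ≡⟨ x∙yz≈y∙xz ((n ∸ a) C k) (a !) _ ⟩
  a ! * (((n ∸ a) C k) * (k ! * (n ∸ a ∸ k) !))
    ≡⟨ cong (a ! *_) (nCk*k!*[n∸k]!≡n! (∸-monoˡ-≤ a b≤n)) ⟩
  a ! * (n ∸ a) ! ∎
  where
  open ≡-Reasoning
  a = ∣ S ∣
  k = b ∸ a
  a+k≡b : a + k ≡ b
  a+k≡b = m+[n∸m]≡n a≤b

chainsThrough-subsets : ∀ {n} (S : Subset n) b → b ≤ ∣ S ∣ →
  ∑𝒫 (λ T → 𝟙 (T ⊆? S) * δ ∣ T ∣ b) * chainCount n b ∣ S ∣ ≡ ∣ S ∣ ! * (n ∸ ∣ S ∣) !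
chainsThrough-subsets {n} S b b≤a = begin
  ∑𝒫 (λ T → 𝟙 (T ⊆? S) * δ ∣ T ∣ b) * chainCount n b a ≡⟨ cong (_* chainCount n b a) (countSubsets S b) ⟩
  (a C b) * (b ! * ((a ∸ b) ! * (n ∸ a) !))            ≡⟨ reassoc (a C b) (b !) _ _ ⟩
  (a C b) * (b ! * (a ∸ b) !) * (n ∸ a) !              ≡⟨ cong (_* (n ∸ a) !) (nCk*k!*[n∸k]!≡n! b≤a) ⟩
  a ! * (n ∸ a) !                                      ∎
  where
  open ≡-Reasoning
  a = ∣ S ∣
  reassoc : ∀ x y z w → x * (y * (z * w)) ≡ x * (y * z) * w
  reassoc = solve-∀

-- Every maximal chain through S contains exactly one set of each size b ≤ n.
∑𝒫-chainsThroughʳ : ∀ {n} (S : Subset n) b → b ≤ n →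
  ∑𝒫 (λ T → δ ∣ T ∣ b * chainsThrough (∣ S ∣) b S T) ≡ ∣ S ∣ ! * (n ∸ ∣ S ∣) !
∑𝒫-chainsThroughʳ {n} S b b≤n with ∣ S ∣ ≤? b
... | yes a≤b = trans (∑𝒫-cong λ T → trans (cong (δ ∣ T ∣ b *_) (chainsThrough-≤ S T a≤b))
                                           (x∙yz≈yx∙z (δ ∣ T ∣ b) (𝟙 (S ⊆? T)) (chainCount n ∣ S ∣ b)))
                      (trans (∑𝒫-*ʳ {n} _ _) (chainsThrough-supersets S b a≤b b≤n))
... | no  a≰b = trans (∑𝒫-cong λ T → trans (cong (δ ∣ T ∣ b *_) (chainsThrough-> S T a≰b))
                                           (x∙yz≈yx∙z (δ ∣ T ∣ b) (𝟙 (T ⊆? S)) (chainCount n b ∣ S ∣)))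
                      (trans (∑𝒫-*ʳ {n} _ _) (chainsThrough-subsets S b (≰⇒≥ a≰b)))

∑𝒫-chainsThroughˡ : ∀ {n} (T : Subset n) a → a ≤ n →
  ∑𝒫 (λ S → δ ∣ S ∣ a * chainsThrough a (∣ T ∣) S T) ≡ ∣ T ∣ ! * (n ∸ ∣ T ∣) !
∑𝒫-chainsThroughˡ {n} T a a≤n with a ≤? ∣ T ∣
... | yes a≤b = trans (∑𝒫-cong λ S → trans (cong (δ ∣ S ∣ a *_) (chainsThrough-≤ S T a≤b))
                                           (x∙yz≈yx∙z (δ ∣ S ∣ a) (𝟙 (S ⊆? T)) (chainCount n a ∣ T ∣)))
                      (trans (∑𝒫-*ʳ {n} _ _) (chainsThrough-subsets T a a≤b))
... | no  a≰b = trans (∑𝒫-cong λ S → trans (cong (δ ∣ S ∣ a *_) (chainsThrough-> S T a≰b))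
                                           (x∙yz≈yx∙z (δ ∣ S ∣ a) (𝟙 (T ⊆? S)) (chainCount n ∣ T ∣ a)))
                      (trans (∑𝒫-*ʳ {n} _ _) (chainsThrough-supersets T a (<⇒≤ (≰⇒> a≰b)) a≤n))

subsetOf : ∀ {m p} {P : Fin m → Set p} → (∀ x → Dec (P x)) → Subset m
subsetOf P? = tabulate (does ∘ P?)

∈subsetOf⁺ : ∀ {m p} {P : Fin m → Set p} (P? : ∀ x → Dec (P x)) {x} → P x → x ∈ subsetOf P?
∈subsetOf⁺ P? {zero} px with P? zero
... | yes _  = here
... | no ¬px = contradiction px ¬px
∈subsetOf⁺ P? {suc x} px = there (∈subsetOf⁺ (P? ∘ suc) px)

∈subsetOf⁻ : ∀ {m p} {P : Fin m → Set p} (P? : ∀ x → Dec (P x)) {x} → x ∈ subsetOf P? → P x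
∈subsetOf⁻ P? {zero} x∈ with P? zero | x∈
... | yes px | _ = px
∈subsetOf⁻ P? {suc x} (there x∈) = ∈subsetOf⁻ (P? ∘ suc) x∈

∣subsetOf∣ : ∀ {m p} {P : Fin m → Set p} (P? : ∀ x → Dec (P x)) → ∣ subsetOf P? ∣ ≡ ∑ ⊤ (𝟙 ∘ P?)
∣subsetOf∣ {zero} P? = refl
∣subsetOf∣ {suc m} P? with P? zero
... | yes _ = cong suc (∣subsetOf∣ (P? ∘ suc))
... | no  _ = ∣subsetOf∣ (P? ∘ suc)

∈-irrelevant : ∀ {m} {x : Fin m} {X : Subset m} (p q : x ∈ X) → p ≡ q
∈-irrelevant here      here      = refl
∈-irrelevant (there p) (there q) = cong there (∈-irrelevant p q)

SizeIn-irrelevant : ∀ {n} {X : Subset (suc n)} {S : Subset n} (p q : SizeIn X S) → p ≡ q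
SizeIn-irrelevant (i , i∈X , eq) (i′ , i′∈X , eq′) with Fin.toℕ-injective (trans eq (sym eq′))
... | refl = cong₂ (λ p q → i , p , q) (∈-irrelevant i∈X i′∈X) (≡-irrelevant eq eq′)

Family-≡ : ∀ {n} {X : Subset (suc n)} {S T : Subset n} {p : SizeIn X S} {q : SizeIn X T} →
           S ≡ T → _≡_ {A = Family n X} (S , p) (T , q)
Family-≡ {X = X} {S} {p = p} {q} refl = cong (S ,_) (SizeIn-irrelevant {X = X} {S} p q)

sizeIn? : ∀ {n} (X : Subset (suc n)) (S : Subset n) → Dec (SizeIn X S)
sizeIn? X S = any? (λ i → (i ∈? X) ×-dec (toℕ i ≟ ∣ S ∣))

sizeIndicator : ∀ {m} → Subset m → ℕ → ℕ
sizeIndicator X k = ∑ X (λ i → δ k (toℕ i))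

sizeIndicator≤1 : ∀ {m} (X : Subset m) k → sizeIndicator X k ≤ 1
sizeIndicator≤1 []            k       = z≤n
sizeIndicator≤1 (inside ∷ X)  zero    = ≤-reflexive (cong suc (∑-zero X))
sizeIndicator≤1 (outside ∷ X) zero    = subst (_≤ 1) (sym (∑-zero X)) z≤n
sizeIndicator≤1 (inside ∷ X)  (suc k) = sizeIndicator≤1 X k
sizeIndicator≤1 (outside ∷ X) (suc k) = sizeIndicator≤1 X k

SizeIn⇒0<sizeIndicator : ∀ {n} (X : Subset (suc n)) (S : Subset n) → SizeIn X S → 0 < sizeIndicator X ∣ S ∣
SizeIn⇒0<sizeIndicator X S (i , i∈X , i≡∣S∣) =
  subst (_≤ sizeIndicator X ∣ S ∣) (𝟙-yes (∣ S ∣ ≟ toℕ i) (sym i≡∣S∣)) (∈⇒≤∑ X (δ ∣ S ∣ ∘ toℕ) i∈X)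

sizeIndicator≢0⇒SizeIn : ∀ {n} (X : Subset (suc n)) (S : Subset n) → sizeIndicator X ∣ S ∣ ≢ 0 → SizeIn X S
sizeIndicator≢0⇒SizeIn X S ≢0 with ∑≢0⇒∃ X (δ ∣ S ∣ ∘ toℕ) ≢0
... | i , i∈X , δ≢0 = i , i∈X , sym (𝟙≢0⇒ (∣ S ∣ ≟ toℕ i) δ≢0)

𝟙-sizeIn?≡sizeIndicator : ∀ {n} (X : Subset (suc n)) (S : Subset n) → 𝟙 (sizeIn? X S) ≡ sizeIndicator X ∣ S ∣
𝟙-sizeIn?≡sizeIndicator X S with sizeIndicator X ∣ S ∣ ≟ 0
... | yes ≡0 = trans (𝟙-no (sizeIn? X S) (λ s → >⇒≢ (SizeIn⇒0<sizeIndicator X S s) ≡0)) (sym ≡0)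
... | no  ≢0 = let s = sizeIndicator≢0⇒SizeIn X S ≢0 in
  trans (𝟙-yes (sizeIn? X S) s) (≤-antisym (SizeIn⇒0<sizeIndicator X S s) (sizeIndicator≤1 X ∣ S ∣))

sizeIndicator-∑𝒫 : ∀ n (X : Subset (suc n)) → ∑𝒫 {n} (λ S → sizeIndicator X ∣ S ∣) ≡ ∑ X (λ i → n C toℕ i)
sizeIndicator-∑𝒫 n X = trans (∑𝒫-∑ {n} X (λ i S → δ ∣ S ∣ (toℕ i))) (∑-cong X (λ i _ → countSubsetsOfSize n (toℕ i)))

module ChainWeighting (n : ℕ) (A B : Subset (suc n)) where

  binom : Fin (suc n) → ℕ
  binom i = n C toℕ i

  term : Fin (suc n) → Fin (suc n) → Subset n → Subset n → ℕ
  term i j S T = δ (∣ S ∣) (toℕ i) * binom i * (δ (∣ T ∣) (toℕ j) * binom j) * chainsThrough (toℕ i) (toℕ j) S T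

  weight : Subset n → Subset n → ℕ
  weight S T = ∑ A (λ i → ∑ B (λ j → term i j S T))

  ∑𝒫-termʳ : ∀ i j S → ∑𝒫 (term i j S) ≡ δ (∣ S ∣) (toℕ i) * (n ! * binom j)
  ∑𝒫-termʳ i j S = begin
    ∑𝒫 (term i j S)
      ≡⟨ ∑𝒫-cong {n} (λ T → regroup (δ (∣ S ∣) (toℕ i)) (binom i) (δ (∣ T ∣) (toℕ j)) (binom j) (chainsThrough (toℕ i) (toℕ j) S T)) ⟩
    ∑𝒫 (λ T → δ (∣ S ∣) (toℕ i) * binom i * binom j * (δ (∣ T ∣) (toℕ j) * chainsThrough (toℕ i) (toℕ j) S T))
      ≡⟨ ∑𝒫-*ˡ {n} (δ (∣ S ∣) (toℕ i) * binom i * binom j) _ ⟩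
    δ (∣ S ∣) (toℕ i) * binom i * binom j * ∑𝒫 (λ T → δ (∣ T ∣) (toℕ j) * chainsThrough (toℕ i) (toℕ j) S T)
      ≡⟨ reassoc (δ (∣ S ∣) (toℕ i)) (binom i) (binom j) _ ⟩
    δ (∣ S ∣) (toℕ i) * F (toℕ i)
      ≡⟨ δ*-transport {∣ S ∣} {toℕ i} F F∣S∣≡n!*binom ⟩
    δ (∣ S ∣) (toℕ i) * (n ! * binom j) ∎
    where
    open ≡-Reasoning
    regroup : ∀ a b c d e → a * b * (c * d) * e ≡ a * b * d * (c * e)
    regroup = solve-∀
    reassoc : ∀ a b c d → a * b * c * d ≡ a * (b * c * d)
    reassoc = solve-∀
    F : ℕ → ℕ
    F a = (n C a) * binom j * ∑𝒫 (λ T → δ (∣ T ∣) (toℕ j) * chainsThrough a (toℕ j) S T)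
    F∣S∣≡n!*binom : F ∣ S ∣ ≡ n ! * binom j
    F∣S∣≡n!*binom = begin
      (n C ∣ S ∣) * binom j * ∑𝒫 (λ T → δ (∣ T ∣) (toℕ j) * chainsThrough (∣ S ∣) (toℕ j) S T)
        ≡⟨ cong ((n C ∣ S ∣) * binom j *_) (∑𝒫-chainsThroughʳ S (toℕ j) (toℕ≤pred[n] j)) ⟩
      (n C ∣ S ∣) * binom j * (∣ S ∣ ! * (n ∸ ∣ S ∣) !)
        ≡⟨ xy∙z≈xz∙y (n C ∣ S ∣) (binom j) _ ⟩
      (n C ∣ S ∣) * (∣ S ∣ ! * (n ∸ ∣ S ∣) !) * binom j
        ≡⟨ cong (_* binom j) (nCk*k!*[n∸k]!≡n! (∣p∣≤n S)) ⟩
      n ! * binom j ∎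

  ∑𝒫-termˡ : ∀ i j T → ∑𝒫 (λ S → term i j S T) ≡ δ (∣ T ∣) (toℕ j) * (n ! * binom i)
  ∑𝒫-termˡ i j T = begin
    ∑𝒫 (λ S → term i j S T)
      ≡⟨ ∑𝒫-cong {n} (λ S → regroup (δ (∣ S ∣) (toℕ i)) (binom i) (δ (∣ T ∣) (toℕ j)) (binom j) (chainsThrough (toℕ i) (toℕ j) S T)) ⟩
    ∑𝒫 (λ S → δ (∣ T ∣) (toℕ j) * binom j * binom i * (δ (∣ S ∣) (toℕ i) * chainsThrough (toℕ i) (toℕ j) S T))
      ≡⟨ ∑𝒫-*ˡ {n} (δ (∣ T ∣) (toℕ j) * binom j * binom i) _ ⟩
    δ (∣ T ∣) (toℕ j) * binom j * binom i * ∑𝒫 (λ S → δ (∣ S ∣) (toℕ i) * chainsThrough (toℕ i) (toℕ j) S T)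
      ≡⟨ reassoc (δ (∣ T ∣) (toℕ j)) (binom j) (binom i) _ ⟩
    δ (∣ T ∣) (toℕ j) * F (toℕ j)
      ≡⟨ δ*-transport {∣ T ∣} {toℕ j} F F∣T∣≡n!*binom ⟩
    δ (∣ T ∣) (toℕ j) * (n ! * binom i) ∎
    where
    open ≡-Reasoning
    regroup : ∀ a b c d e → a * b * (c * d) * e ≡ c * d * b * (a * e)
    regroup = solve-∀
    reassoc : ∀ a b c d → a * b * c * d ≡ a * (b * c * d)
    reassoc = solve-∀
    F : ℕ → ℕ
    F b = (n C b) * binom i * ∑𝒫 (λ S → δ (∣ S ∣) (toℕ i) * chainsThrough (toℕ i) b S T)
    F∣T∣≡n!*binom : F ∣ T ∣ ≡ n ! * binom i
    F∣T∣≡n!*binom = begin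
      (n C ∣ T ∣) * binom i * ∑𝒫 (λ S → δ (∣ S ∣) (toℕ i) * chainsThrough (toℕ i) (∣ T ∣) S T)
        ≡⟨ cong ((n C ∣ T ∣) * binom i *_) (∑𝒫-chainsThroughˡ T (toℕ i) (toℕ≤pred[n] i)) ⟩
      (n C ∣ T ∣) * binom i * (∣ T ∣ ! * (n ∸ ∣ T ∣) !)
        ≡⟨ xy∙z≈xz∙y (n C ∣ T ∣) (binom i) _ ⟩
      (n C ∣ T ∣) * (∣ T ∣ ! * (n ∸ ∣ T ∣) !) * binom i
        ≡⟨ cong (_* binom i) (nCk*k!*[n∸k]!≡n! (∣p∣≤n T)) ⟩
      n ! * binom i ∎

  ∑𝒫-weightʳ : ∀ S → ∑𝒫 (weight S) ≡ sizeIndicator A ∣ S ∣ * (n ! * ∑ B binom)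
  ∑𝒫-weightʳ S = begin
    ∑𝒫 (λ T → ∑ A (λ i → ∑ B (λ j → term i j S T)))
      ≡⟨ ∑𝒫-∑ A (λ i T → ∑ B (λ j → term i j S T)) ⟩
    ∑ A (λ i → ∑𝒫 (λ T → ∑ B (λ j → term i j S T)))
      ≡⟨ ∑-cong A (λ i _ → trans (∑𝒫-∑ B (λ j → term i j S)) (∑-cong B (λ j _ → ∑𝒫-termʳ i j S))) ⟩
    ∑ A (λ i → ∑ B (λ j → δ (∣ S ∣) (toℕ i) * (n ! * binom j)))
      ≡⟨ ∑-cong A (λ i _ → trans (∑-*ˡ B (δ (∣ S ∣) (toℕ i)) _) (cong (δ (∣ S ∣) (toℕ i) *_) (∑-*ˡ B (n !) binom))) ⟩
    ∑ A (λ i → δ (∣ S ∣) (toℕ i) * (n ! * ∑ B binom))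
      ≡⟨ ∑-*ʳ A _ _ ⟩
    sizeIndicator A ∣ S ∣ * (n ! * ∑ B binom) ∎
    where open ≡-Reasoning

  ∑𝒫-weightˡ : ∀ T → ∑𝒫 (λ S → weight S T) ≡ sizeIndicator B ∣ T ∣ * (n ! * ∑ A binom)
  ∑𝒫-weightˡ T = begin
    ∑𝒫 (λ S → ∑ A (λ i → ∑ B (λ j → term i j S T)))
      ≡⟨ ∑𝒫-∑ A (λ i S → ∑ B (λ j → term i j S T)) ⟩
    ∑ A (λ i → ∑𝒫 (λ S → ∑ B (λ j → term i j S T)))
      ≡⟨ ∑-cong A (λ i _ → trans (∑𝒫-∑ B (λ j S → term i j S T)) (∑-cong B (λ j _ → ∑𝒫-termˡ i j T))) ⟩
    ∑ A (λ i → ∑ B (λ j → δ (∣ T ∣) (toℕ j) * (n ! * binom i)))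
      ≡⟨ ∑-swap A B _ ⟩
    ∑ B (λ j → ∑ A (λ i → δ (∣ T ∣) (toℕ j) * (n ! * binom i)))
      ≡⟨ ∑-cong B (λ j _ → trans (∑-*ˡ A (δ (∣ T ∣) (toℕ j)) _) (cong (δ (∣ T ∣) (toℕ j) *_) (∑-*ˡ A (n !) binom))) ⟩
    ∑ B (λ j → δ (∣ T ∣) (toℕ j) * (n ! * ∑ A binom))
      ≡⟨ ∑-*ʳ B _ _ ⟩
    sizeIndicator B ∣ T ∣ * (n ! * ∑ A binom) ∎
    where open ≡-Reasoning

  weight≢0⇒comparable : ∀ S T → weight S T ≢ 0 → S ⊆ T ⊎ T ⊆ S
  weight≢0⇒comparable S T w≢0 with ∑≢0⇒∃ A _ w≢0
  ... | i , _ , ∑≢0 with ∑≢0⇒∃ B _ ∑≢0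
  ...   | j , _ , term≢0 = chainsThrough≢0⇒comparable (toℕ i) (toℕ j) S T
    (*≢0⇒≢0ʳ (δ (∣ S ∣) (toℕ i) * binom i * (δ (∣ T ∣) (toℕ j) * binom j)) term≢0)

  vertices : Subset (suc n) → Subset (∣𝒫∣ n)
  vertices X = subsetOf (λ x → sizeIn? X (fromFin n x))

  ∣vertices∣ : ∀ X → ∣ vertices X ∣ ≡ ∑ X binom
  ∣vertices∣ X = begin
    ∣ vertices X ∣                    ≡⟨ ∣subsetOf∣ (λ x → sizeIn? X (fromFin n x)) ⟩
    ∑ ⊤ (𝟙 ∘ sizeIn? X ∘ fromFin n)     ≡⟨ ∑⊤∘fromFin≡∑𝒫 n (𝟙 ∘ sizeIn? X) ⟩
    ∑𝒫 (𝟙 ∘ sizeIn? X)               ≡⟨ ∑𝒫-cong {n} (𝟙-sizeIn?≡sizeIndicator X) ⟩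
    ∑𝒫 {n} (λ S → sizeIndicator X ∣ S ∣) ≡⟨ sizeIndicator-∑𝒫 n X ⟩
    ∑ X binom                        ∎
    where open ≡-Reasoning

  toVertex : ∀ X S → SizeIn X S → toFin S ∈ vertices X
  toVertex X S s = ∈subsetOf⁺ (λ x → sizeIn? X (fromFin n x)) (subst (SizeIn X) (sym (fromFin∘toFin S)) s)

  fromVertex : ∀ X {x} → x ∈ vertices X → SizeIn X (fromFin n x)
  fromVertex X = ∈subsetOf⁻ (λ x → sizeIn? X (fromFin n x))

  W : Fin (∣𝒫∣ n) → Fin (∣𝒫∣ n) → ℕ
  W x y = weight (fromFin n x) (fromFin n y)

  G : Graph (∣𝒫∣ n) (∣𝒫∣ n)
  G x = subsetOf (λ y → ¬? (W x y ≟ 0))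

  ∑-Wʳ : ∀ x → ∑ ⊤ (W x) ≡ sizeIndicator A ∣ fromFin n x ∣ * (n ! * ∑ B binom)
  ∑-Wʳ x = trans (∑⊤∘fromFin≡∑𝒫 n (weight (fromFin n x))) (∑𝒫-weightʳ (fromFin n x))

  ∑-Wˡ : ∀ y → ∑ ⊤ (λ x → W x y) ≡ sizeIndicator B ∣ fromFin n y ∣ * (n ! * ∑ A binom)
  ∑-Wˡ y = trans (∑⊤∘fromFin≡∑𝒫 n (λ S → weight S (fromFin n y))) (∑𝒫-weightˡ (fromFin n y))

  G⊆vertices : ∀ x → G x ⊆ vertices B
  G⊆vertices x {y} y∈Gx = ∈subsetOf⁺ (λ y → sizeIn? B (fromFin n y)) (sizeIndicator≢0⇒SizeIn B (fromFin n y) λ ≡0 → W≢0 (n≤0⇒n≡0 (begin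
    W x y                                             ≤⟨ ∈⇒≤∑ ⊤ (λ x → W x y) ∈⊤ ⟩
    ∑ ⊤ (λ x → W x y)                                 ≡⟨ ∑-Wˡ y ⟩
    sizeIndicator B ∣ fromFin n y ∣ * (n ! * ∑ A binom) ≡⟨ cong (_* (n ! * ∑ A binom)) ≡0 ⟩
    0                                                 ∎)))
    where
    open ≤-Reasoning
    W≢0 : W x y ≢ 0
    W≢0 = ∈subsetOf⁻ (λ y → ¬? (W x y ≟ 0)) y∈Gx

  module _ (balanced : ∑ A binom ≡ ∑ B binom) where

    hallCondition : HallCondition G (vertices A)
    hallCondition = weighting⇒HallCondition G (vertices A) W (n ! * ∑ A binom)
      (λ x y W≢0 → ∈subsetOf⁺ (λ y → ¬? (W x y ≟ 0)) W≢0) outflow inflow positive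
      where
      outflow : ∀ x → x ∈ vertices A → n ! * ∑ A binom ≤ ∑ ⊤ (W x)
      outflow x x∈A = begin
        n ! * ∑ A binom                                   ≤⟨ m≤n*m _ _ {{>-nonZero (SizeIn⇒0<sizeIndicator A (fromFin n x) (fromVertex A x∈A))}} ⟩
        sizeIndicator A ∣ fromFin n x ∣ * (n ! * ∑ A binom) ≡⟨ cong (λ M → sizeIndicator A ∣ fromFin n x ∣ * (n ! * M)) balanced ⟩
        sizeIndicator A ∣ fromFin n x ∣ * (n ! * ∑ B binom) ≡⟨ ∑-Wʳ x ⟨
        ∑ ⊤ (W x)                                         ∎
        where open ≤-Reasoning
      inflow : ∀ y → ∑ (vertices A) (λ x → W x y) ≤ n ! * ∑ A binom
      inflow y = begin
        ∑ (vertices A) (λ x → W x y)                      ≤⟨ ∑-mono-⊆ {X = vertices A} (λ x → W x y) (λ _ → ∈⊤) ⟩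
        ∑ ⊤ (λ x → W x y)                                 ≡⟨ ∑-Wˡ y ⟩
        sizeIndicator B ∣ fromFin n y ∣ * (n ! * ∑ A binom) ≤⟨ *-monoˡ-≤ _ (sizeIndicator≤1 B ∣ fromFin n y ∣) ⟩
        1 * (n ! * ∑ A binom)                             ≡⟨ *-identityˡ _ ⟩
        n ! * ∑ A binom                                   ∎
        where open ≤-Reasoning
      positive : ∀ {x} → x ∈ vertices A → 0 < n ! * ∑ A binom
      positive x∈A = *-mono-≤ (1≤n! n) (subst (0 <_) (∣vertices∣ A) (x∈p⇒0<∣p∣ x∈A))

    open Matching (rado G (vertices A) hallCondition)

    Φ : Family n A → Family n B
    Φ (S , s) = fromFin n y , fromVertex B (G⊆vertices (toFin S) (mate∈G (toFin S) (toVertex A S s)))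
      where y = mate (toFin S) (toVertex A S s)

    Φ-injective : Injective _≡_ _≡_ Φ
    Φ-injective {S , s} {S′ , s′} ΦS≡ΦS′ = Family-≡ (begin
      S                   ≡⟨ fromFin∘toFin S ⟨
      fromFin n (toFin S)   ≡⟨ cong (fromFin n) (mate-injective (toVertex A S s) (toVertex A S′ s′) mates≡) ⟩
      fromFin n (toFin S′)  ≡⟨ fromFin∘toFin S′ ⟩
      S′                  ∎)
      where
      open ≡-Reasoning
      mates≡ : mate (toFin S) (toVertex A S s) ≡ mate (toFin S′) (toVertex A S′ s′)
      mates≡ = trans (sym (toFin∘fromFin n (mate (toFin S) (toVertex A S s))))
                     (trans (cong (toFin ∘ proj₁) ΦS≡ΦS′) (toFin∘fromFin n (mate (toFin S′) (toVertex A S′ s′))))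

    Φ-surjective : Surjective _≡_ _≡_ Φ
    Φ-surjective (T , t) = preimage (mate-surjective (λ x _ → G⊆vertices x) ∣B∣≤∣A∣ (toVertex B T t))
      where
      ∣B∣≤∣A∣ : ∣ vertices B ∣ ≤ ∣ vertices A ∣
      ∣B∣≤∣A∣ = ≤-reflexive (trans (∣vertices∣ B) (trans (sym balanced) (sym (∣vertices∣ A))))
      preimage : (∃ λ x → Σ (x ∈ vertices A) λ x∈A → mate x x∈A ≡ toFin T) → ∃ λ a → ∀ {z} → z ≡ a → Φ z ≡ (T , t)
      preimage (x , x∈A , mate≡T) = (fromFin n x , fromVertex A x∈A) , λ { refl → Family-≡ (begin
        fromFin n (mate (toFin (fromFin n x)) x∈A′) ≡⟨ cong (fromFin n) (mate-cong x∈A′ x∈A (toFin∘fromFin n x)) ⟩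
        fromFin n (mate x x∈A)                      ≡⟨ cong (fromFin n) mate≡T ⟩
        fromFin n (toFin T)                         ≡⟨ fromFin∘toFin T ⟩
        T                                           ∎) }
        where
        open ≡-Reasoning
        x∈A′ : toFin (fromFin n x) ∈ vertices A
        x∈A′ = toVertex A (fromFin n x) (fromVertex A x∈A)

    Φ-comparable : ∀ S → proj₁ S ⊆ proj₁ (Φ S) ⊎ proj₁ (Φ S) ⊆ proj₁ S
    Φ-comparable (S , s) = subst (λ R → R ⊆ proj₁ (Φ (S , s)) ⊎ proj₁ (Φ (S , s)) ⊆ R) (fromFin∘toFin S)
      (weight≢0⇒comparable _ _ (∈subsetOf⁻ (λ y → ¬? (W (toFin S) y ≟ 0)) (mate∈G (toFin S) (toVertex A S s))))

    orderable : Orderable n A B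
    -- Φ-injective is eta-expanded by hand: solving its implicit arguments by unification
    -- would make Agda unfold Φ, and with it the matching produced by rado.
    orderable = mk⤖ {to = Φ} ((λ {a} {b} → Φ-injective {a} {b}) , Φ-surjective) , Φ-comparable

theorem1p3 : (n : ℕ) (A B : Subset (suc n)) →
    Disjoint A B →
    binomSum n A ≡ binomSum n B →
    Orderable n A B
theorem1p3 n A B _ sums≡ = ChainWeighting.orderable n A B (begin
  ∑ A (λ i → n C toℕ i) ≡⟨ sumOver≡∑ A (n C_) ⟨
  binomSum n A          ≡⟨ sums≡ ⟩
  binomSum n B          ≡⟨ sumOver≡∑ B (n C_) ⟩
  ∑ B (λ i → n C toℕ i) ∎)
  where open ≡-Reasoning
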